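{- Let $F_2$ be a formula of the propositional provability calculus that does not preserve the unary relation $\{\sigma,\mathbb{1}\}$ on $\mathfrak{B}_2$. Then some formula $B(p)$ in one variable with $B[\mathbb{1}]\in\{\mathbb{0},\rho\}$ is expressible in $L\mathfrak{B}_2$ via $F_2$.
   Context: Formulas of the propositional provability calculus are built from propositional variables using $\&,\vee,\supset,\neg$ and the unary modal connective $\Delta$. The algebra $\mathfrak{B}_2=(\{\mathbb{0},\rho,\sigma,\mathbb{1}\};\&,\vee,\supset,\neg,\Delta)$ is the four-element Boolean algebra with least element $\mathbb{0}$, greatest element $\mathbb{1}$ and atoms $\rho,\sigma$ (so $\neg\rho=\sigma$), with usual Boolean operations and $\Delta\mathbb{0}=\Delta\rho=\sigma$, $\Delta\sigma=\Delta\mathbb{1}=\mathbb{1}$. $F[\alpha_1,\dots,\alpha_n]$ is the value of $F(p_1,\dots,p_n)$ on $\mathfrak{B}_2$ when $p_i$ takes value $\alpha_i$. $L\mathfrak{B}_2$ is the set of formulas taking value $\mathbb{1}$ under every evaluation on $\mathfrak{B}_2$; $A,B$ are equivalent in $L\mathfrak{B}_2$ if $(A\supset B)\&(B\supset A)\in L\mathfrak{B}_2$. A formula $F(p_1,\dots,p_n)$ preserves a unary relation $S\subseteq\mathfrak{B}_2$ if $\alpha_1,\dots,\alpha_n\in S$ implies $F[\alpha_1,\dots,\alpha_n]\in S$. A formula is expressible via a set of formulas $\Sigma$ in $L\mathfrak{B}_2$ if it belongs to the smallest set of formulas containing all propositional variables and all formulas of $\Sigma$ and closed under weak substitution (from $A$,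 $B$ obtain $A[p/B]$, the result of substituting $B$ for a variable $p$ in $A$) and under replacement by formulas equivalent in $L\mathfrak{B}_2$. -}

module Defs where

open import Data.Nat using (ℕ; _≟_)
open import Data.Empty using (⊥)
open import Data.Unit using (⊤)
open import Data.Product using (_×_)
open import Data.Sum using (_⊎_)
open import Relation.Nullary using (¬_; yes; no)
open import Relation.Binary.PropositionalEquality using (_≡_)

data Formula : Set where
  var  : ℕ → Formula
  _&_  : Formula → Formula → Formula
  _∨_  : Formula → Formula → Formula
  _⊃_  : Formula → Formula → Formula
  ¬'_  : Formula → Formula
  Δ_   : Formula → Formula

data B2 : Set where
  𝟘 ρ σ 𝟙 : B2

neg : B2 → B2
neg 𝟘 = 𝟙
neg ρ = σ
neg σ = ρ
neg 𝟙 = 𝟘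

conj : B2 → B2 → B2
conj 𝟘 y = 𝟘
conj 𝟙 y = y
conj ρ 𝟘 = 𝟘
conj ρ ρ = ρ
conj ρ σ = 𝟘
conj ρ 𝟙 = ρ
conj σ 𝟘 = 𝟘
conj σ ρ = 𝟘
conj σ σ = σ
conj σ 𝟙 = σ

disj : B2 → B2 → B2
disj x y = neg (conj (neg x) (neg y))

impl : B2 → B2 → B2
impl x y = disj (neg x) y

delta : B2 → B2
delta 𝟘 = σ
delta ρ = σ
delta σ = 𝟙
delta 𝟙 = 𝟙

⟦_⟧ : Formula → (ℕ → B2) → B2
⟦ var i ⟧ v = v i
⟦ A & B ⟧ v = conj (⟦ A ⟧ v) (⟦ B ⟧ v)
⟦ A ∨ B ⟧ v = disj (⟦ A ⟧ v) (⟦ B ⟧ v)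
⟦ A ⊃ B ⟧ v = impl (⟦ A ⟧ v) (⟦ B ⟧ v)
⟦ ¬' A ⟧ v = neg (⟦ A ⟧ v)
⟦ Δ A ⟧ v = delta (⟦ A ⟧ v)

InL : Formula → Set
InL A = ∀ (v : ℕ → B2) → ⟦ A ⟧ v ≡ 𝟙

Equiv : Formula → Formula → Set
Equiv A B = InL ((A ⊃ B) & (B ⊃ A))

_[_/_] : Formula → ℕ → Formula → Formula
var i [ p / B ] with i ≟ p
... | yes _ = B
... | no _ = var i
(A₁ & A₂) [ p / B ] = (A₁ [ p / B ]) & (A₂ [ p / B ])
(A₁ ∨ A₂) [ p / B ] = (A₁ [ p / B ]) ∨ (A₂ [ p / B ])
(A₁ ⊃ A₂) [ p / B ] = (A₁ [ p / B ]) ⊃ (A₂ [ p / B ])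
(¬' A) [ p / B ] = ¬' (A [ p / B ])
(Δ A) [ p / B ] = Δ (A [ p / B ])

Preserves : Formula → (B2 → Set) → Set
Preserves F S = ∀ (v : ℕ → B2) → (∀ i → S (v i)) → S (⟦ F ⟧ v)

Sσ𝟙 : B2 → Set
Sσ𝟙 x = (x ≡ σ) ⊎ (x ≡ 𝟙)

data Expressible (Σ' : Formula → Set) : Formula → Set where
  ex-var   : ∀ i → Expressible Σ' (var i)
  ex-base  : ∀ {A} → Σ' A → Expressible Σ' A
  ex-subst : ∀ {A B} p → Expressible Σ' A → Expressible Σ' B → Expressible Σ' (A [ p / B ])
  ex-equiv : ∀ {A B} → Expressible Σ' A → Equiv A B → Expressible Σ' B

OnlyVar : ℕ → Formula → Set
OnlyVar p (var i) = i ≡ p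
OnlyVar p (A & B) = OnlyVar p A × OnlyVar p B
OnlyVar p (A ∨ B) = OnlyVar p A × OnlyVar p B
OnlyVar p (A ⊃ B) = OnlyVar p A × OnlyVar p B
OnlyVar p (¬' A) = OnlyVar p A
OnlyVar p (Δ A) = OnlyVar p A

module Submission where

-- The map upper : 𝔅₂ → Bool, which sends x to whether x ∈ {σ, 𝟙}, is a homomorphism of
-- the Boolean operations, and Δ always lands in {σ, 𝟙}. Hence on evaluations with values
-- in {σ, 𝟙} the value of a formula lies in {σ, 𝟙} exactly when F[𝟙, …, 𝟙] does, so a formula
-- not preserving {σ, 𝟙} has F[𝟙, …, 𝟙] ∈ {𝟘, ρ}. Identifying all variables of F with p₀ by
-- successive substitutions gives the required one-variable formula with the same value at 𝟙.

open import Defs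
open import Data.Nat using (ℕ; zero; suc; _≤_; z≤n; s≤s; _⊔_; _≟_)
open import Data.Nat.Properties using (≤-refl; ≤-trans; m≤m⊔n; m≤n⊔m; ≤∧≢⇒<)
open import Data.Bool using (Bool; true; false; _∧_; not)
open import Data.Product using (Σ; _×_; _,_)
open import Data.Sum using (_⊎_; inj₁; inj₂)
open import Data.Empty using (⊥-elim)
open import Relation.Nullary using (¬_; yes; no)
open import Relation.Binary.PropositionalEquality using (_≡_; refl; cong; cong₂; sym; trans; subst)

upper : B2 → Bool
upper 𝟘 = false
upper ρ = false
upper σ = true
upper 𝟙 = true

upper-neg : ∀ x → upper (neg x) ≡ not (upper x)
upper-neg 𝟘 = refl
upper-neg ρ = refl
upper-neg σ = refl
upper-neg 𝟙 = refl

upper-conj : ∀ x y → upper (conj x y) ≡ upper x ∧ upper y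
upper-conj 𝟘 y = refl
upper-conj 𝟙 𝟘 = refl
upper-conj 𝟙 ρ = refl
upper-conj 𝟙 σ = refl
upper-conj 𝟙 𝟙 = refl
upper-conj ρ 𝟘 = refl
upper-conj ρ ρ = refl
upper-conj ρ σ = refl
upper-conj ρ 𝟙 = refl
upper-conj σ 𝟘 = refl
upper-conj σ ρ = refl
upper-conj σ σ = refl
upper-conj σ 𝟙 = refl

upper-delta : ∀ x → upper (delta x) ≡ true
upper-delta 𝟘 = refl
upper-delta ρ = refl
upper-delta σ = refl
upper-delta 𝟙 = refl

upper-neg-cong : ∀ {x y} → upper x ≡ upper y → upper (neg x) ≡ upper (neg y)
upper-neg-cong {x} {y} e = trans (upper-neg x) (trans (cong not e) (sym (upper-neg y)))

upper-conj-cong : ∀ {x x′ y y′} → upper x ≡ upper x′ → upper y ≡ upper y′ →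
                  upper (conj x y) ≡ upper (conj x′ y′)
upper-conj-cong {x} {x′} {y} {y′} ex ey =
  trans (upper-conj x y) (trans (cong₂ _∧_ ex ey) (sym (upper-conj x′ y′)))

-- disj and impl unfold definitionally into neg and conj.
upper-⟦⟧-cong : ∀ A {v w : ℕ → B2} → (∀ i → upper (v i) ≡ upper (w i)) →
                upper (⟦ A ⟧ v) ≡ upper (⟦ A ⟧ w)
upper-⟦⟧-cong (var i) e = e i
upper-⟦⟧-cong (A & B) e = upper-conj-cong (upper-⟦⟧-cong A e) (upper-⟦⟧-cong B e)
upper-⟦⟧-cong (A ∨ B) e =
  upper-neg-cong (upper-conj-cong (upper-neg-cong (upper-⟦⟧-cong A e))
                                  (upper-neg-cong (upper-⟦⟧-cong B e)))
upper-⟦⟧-cong (A ⊃ B) e =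
  upper-neg-cong (upper-conj-cong (upper-neg-cong (upper-neg-cong (upper-⟦⟧-cong A e)))
                                  (upper-neg-cong (upper-⟦⟧-cong B e)))
upper-⟦⟧-cong (¬' A) e = upper-neg-cong (upper-⟦⟧-cong A e)
upper-⟦⟧-cong (Δ A) {v} {w} _ = trans (upper-delta (⟦ A ⟧ v)) (sym (upper-delta (⟦ A ⟧ w)))

Sσ𝟙⇒upper : ∀ {x} → Sσ𝟙 x → upper x ≡ true
Sσ𝟙⇒upper (inj₁ refl) = refl
Sσ𝟙⇒upper (inj₂ refl) = refl

upper⇒Sσ𝟙 : ∀ x → upper x ≡ true → Sσ𝟙 x
upper⇒Sσ𝟙 σ _ = inj₁ refl
upper⇒Sσ𝟙 𝟙 _ = inj₂ refl

const𝟙 : ℕ → B2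
const𝟙 _ = 𝟙

preserves-Sσ𝟙 : ∀ F → Sσ𝟙 (⟦ F ⟧ const𝟙) → Preserves F Sσ𝟙
preserves-Sσ𝟙 F s v v∈S = upper⇒Sσ𝟙 (⟦ F ⟧ v)
  (trans (upper-⟦⟧-cong F λ i → Sσ𝟙⇒upper (v∈S i)) (Sσ𝟙⇒upper s))

¬preserves⇒⟦⟧const𝟙∈𝟘ρ : ∀ F → ¬ Preserves F Sσ𝟙 →
                        (⟦ F ⟧ const𝟙 ≡ 𝟘) ⊎ (⟦ F ⟧ const𝟙 ≡ ρ)
¬preserves⇒⟦⟧const𝟙∈𝟘ρ F ¬pres with ⟦ F ⟧ const𝟙 in eq
... | 𝟘 = inj₁ refl
... | ρ = inj₂ refl
... | σ = ⊥-elim (¬pres (preserves-Sσ𝟙 F (subst Sσ𝟙 (sym eq) (inj₁ refl))))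
... | 𝟙 = ⊥-elim (¬pres (preserves-Sσ𝟙 F (subst Sσ𝟙 (sym eq) (inj₂ refl))))

⟦⟧-subst-var : ∀ A p q (v : ℕ → B2) → v p ≡ v q → ⟦ A [ p / var q ] ⟧ v ≡ ⟦ A ⟧ v
⟦⟧-subst-var (var i) p q v e with i ≟ p
... | yes refl = sym e
... | no _ = refl
⟦⟧-subst-var (A & B) p q v e = cong₂ conj (⟦⟧-subst-var A p q v e) (⟦⟧-subst-var B p q v e)
⟦⟧-subst-var (A ∨ B) p q v e = cong₂ disj (⟦⟧-subst-var A p q v e) (⟦⟧-subst-var B p q v e)
⟦⟧-subst-var (A ⊃ B) p q v e = cong₂ impl (⟦⟧-subst-var A p q v e) (⟦⟧-subst-var B p q v e)
⟦⟧-subst-var (¬' A) p q v e = cong neg (⟦⟧-subst-var A p q v e)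
⟦⟧-subst-var (Δ A) p q v e = cong delta (⟦⟧-subst-var A p q v e)

VarsBelow : ℕ → Formula → Set
VarsBelow n (var i) = i ≤ n
VarsBelow n (A & B) = VarsBelow n A × VarsBelow n B
VarsBelow n (A ∨ B) = VarsBelow n A × VarsBelow n B
VarsBelow n (A ⊃ B) = VarsBelow n A × VarsBelow n B
VarsBelow n (¬' A) = VarsBelow n A
VarsBelow n (Δ A) = VarsBelow n A

maxVar : Formula → ℕ
maxVar (var i) = i
maxVar (A & B) = maxVar A ⊔ maxVar B
maxVar (A ∨ B) = maxVar A ⊔ maxVar B
maxVar (A ⊃ B) = maxVar A ⊔ maxVar B
maxVar (¬' A) = maxVar A
maxVar (Δ A) = maxVar A

varsBelow-mono : ∀ {m n} A → m ≤ n → VarsBelow m A → VarsBelow n A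
varsBelow-mono (var i) m≤n h = ≤-trans h m≤n
varsBelow-mono (A & B) m≤n (a , b) = varsBelow-mono A m≤n a , varsBelow-mono B m≤n b
varsBelow-mono (A ∨ B) m≤n (a , b) = varsBelow-mono A m≤n a , varsBelow-mono B m≤n b
varsBelow-mono (A ⊃ B) m≤n (a , b) = varsBelow-mono A m≤n a , varsBelow-mono B m≤n b
varsBelow-mono (¬' A) m≤n a = varsBelow-mono A m≤n a
varsBelow-mono (Δ A) m≤n a = varsBelow-mono A m≤n a

varsBelow-maxVar : ∀ A → VarsBelow (maxVar A) A
varsBelow-maxVar (var i) = ≤-refl
varsBelow-maxVar (A & B) = varsBelow-mono A (m≤m⊔n _ _) (varsBelow-maxVar A)
                         , varsBelow-mono B (m≤n⊔m _ _) (varsBelow-maxVar B)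
varsBelow-maxVar (A ∨ B) = varsBelow-mono A (m≤m⊔n _ _) (varsBelow-maxVar A)
                         , varsBelow-mono B (m≤n⊔m _ _) (varsBelow-maxVar B)
varsBelow-maxVar (A ⊃ B) = varsBelow-mono A (m≤m⊔n _ _) (varsBelow-maxVar A)
                         , varsBelow-mono B (m≤n⊔m _ _) (varsBelow-maxVar B)
varsBelow-maxVar (¬' A) = varsBelow-maxVar A
varsBelow-maxVar (Δ A) = varsBelow-maxVar A

varsBelow-subst-top : ∀ n A → VarsBelow (suc n) A → VarsBelow n (A [ suc n / var 0 ])
varsBelow-subst-top n (var i) i≤1+n with i ≟ suc n
... | yes _ = z≤n
... | no i≢1+n with ≤∧≢⇒< i≤1+n i≢1+n
...   | s≤s i≤n = i≤n
varsBelow-subst-top n (A & B) (a , b) = varsBelow-subst-top n A a , varsBelow-subst-top n B b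
varsBelow-subst-top n (A ∨ B) (a , b) = varsBelow-subst-top n A a , varsBelow-subst-top n B b
varsBelow-subst-top n (A ⊃ B) (a , b) = varsBelow-subst-top n A a , varsBelow-subst-top n B b
varsBelow-subst-top n (¬' A) a = varsBelow-subst-top n A a
varsBelow-subst-top n (Δ A) a = varsBelow-subst-top n A a

varsBelow0⇒onlyVar0 : ∀ A → VarsBelow 0 A → OnlyVar 0 A
varsBelow0⇒onlyVar0 (var .0) z≤n = refl
varsBelow0⇒onlyVar0 (A & B) (a , b) = varsBelow0⇒onlyVar0 A a , varsBelow0⇒onlyVar0 B b
varsBelow0⇒onlyVar0 (A ∨ B) (a , b) = varsBelow0⇒onlyVar0 A a , varsBelow0⇒onlyVar0 B b
varsBelow0⇒onlyVar0 (A ⊃ B) (a , b) = varsBelow0⇒onlyVar0 A a , varsBelow0⇒onlyVar0 B b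
varsBelow0⇒onlyVar0 (¬' A) a = varsBelow0⇒onlyVar0 A a
varsBelow0⇒onlyVar0 (Δ A) a = varsBelow0⇒onlyVar0 A a

collapse : ℕ → Formula → Formula
collapse zero A = A
collapse (suc n) A = collapse n (A [ suc n / var 0 ])

onlyVar0-collapse : ∀ n A → VarsBelow n A → OnlyVar 0 (collapse n A)
onlyVar0-collapse zero A h = varsBelow0⇒onlyVar0 A h
onlyVar0-collapse (suc n) A h = onlyVar0-collapse n _ (varsBelow-subst-top n A h)

expressible-collapse : ∀ {Σ′} n {A} → Expressible Σ′ A → Expressible Σ′ (collapse n A)
expressible-collapse zero e = e
expressible-collapse (suc n) e = expressible-collapse n (ex-subst (suc n) e (ex-var 0))

⟦collapse⟧-const𝟙 : ∀ n A → ⟦ collapse n A ⟧ const𝟙 ≡ ⟦ A ⟧ const𝟙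
⟦collapse⟧-const𝟙 zero A = refl
⟦collapse⟧-const𝟙 (suc n) A =
  trans (⟦collapse⟧-const𝟙 n _) (⟦⟧-subst-var A (suc n) 0 const𝟙 refl)

lemma2 : (F₂ : Formula) → ¬ Preserves F₂ Sσ𝟙 →
    Σ Formula (λ B → Σ ℕ (λ p →
      OnlyVar p B
      × Expressible (λ A → A ≡ F₂) B
      × ((⟦ B ⟧ (λ _ → 𝟙) ≡ 𝟘) ⊎ (⟦ B ⟧ (λ _ → 𝟙) ≡ ρ))))
lemma2 F ¬pres =
    collapse n F , 0
  , onlyVar0-collapse n F (varsBelow-maxVar F)
  , expressible-collapse n (ex-base refl)
  , subst (λ b → (b ≡ 𝟘) ⊎ (b ≡ ρ)) (sym (⟦collapse⟧-const𝟙 n F))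
          (¬preserves⇒⟦⟧const𝟙∈𝟘ρ F ¬pres)
  where n = maxVar F
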